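{- Let $\Pi X.\, s\ [\exists\vec{x}.\,\varphi]$ be an existentially constrained term. Then $\Pi X.\, s\ [\exists\vec{x}.\,\varphi] \sim \mathrm{PG}(\Pi X.\, s\ [\exists\vec{x}.\,\varphi])$.
   Context: Fix a many-sorted signature whose sorts are partitioned into theory sorts and term sorts and whose function symbols are partitioned into theory symbols (all argument and result sorts are theory sorts) and term symbols; terms are built from these symbols and sorted variables. A fixed model $\mathcal{M}$ interprets theory sorts and theory symbols; the sort Bool is interpreted as $\{\mathsf{true},\mathsf{false}\}$, the usual connectives and equality are available as theory symbols, and every element of the interpretation of every theory sort is a constant symbol of the signature, called a value; $\mathcal{V}al$ is the set of values. A logical constraint is a Bool-sorted term built from theory symbols and variables. A valuation $\rho$ maps theory-sorted variables to elements of the interpretations of their sorts; $\vDash_{\mathcal{M},\rho}\varphi$ means $\varphi$ evaluates to true under $\rho$. Substitutions are sort-preserving; $\sigma|_U$ agrees with $\sigma$ on $U$ and is the identity elsewhere; $\sigma$ is $X$-valued if $\sigma(X)\subseteq\mathcal{V}al$. $\mathcal{V}ar(\cdot)$ denotes the set of variables occurring in an expression. For a term $s$: $s|_p$ is the subterm at position $p$, $s(p)$ the symbol at $p$, $\mathcal{P}os_U(s)$ the set of positions $p$ with $s(p)\in U$, and $s[t_1,\dots,t_n]_{p_1,\dots,p_n}$ the result of replacing the subterms at parallel positions $p_i$ by $t_i$. An existential constraint $\exists\vec{x}.\,\varphi$ is a pair of a sequence of variables $\vec{x}$ and a logical constraint $\varphi$ with $\{\vec{x}\}\subseteq\mathcal{V}ar(\varphi)$;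 its free variables are $\mathcal{FV}ar(\exists\vec{x}.\varphi)=\mathcal{V}ar(\varphi)\setminus\{\vec{x}\}$. $\vDash_{\mathcal{M},\rho}\exists\vec{x}.\varphi$ iff there are values $\vec{v}$ with $\vDash_{\mathcal{M},\rho}\varphi\{\vec{x}\mapsto\vec{v}\}$. For a substitution $\sigma$, $(\exists\vec{x}.\varphi)\sigma := \exists\vec{x}.(\varphi\,\sigma|_{\mathcal{FV}ar(\exists\vec{x}.\varphi)})$, and $\sigma\vDash_{\mathcal{M}}\exists\vec{x}.\varphi$ means $\sigma(\mathcal{FV}ar(\exists\vec{x}.\varphi))\subseteq\mathcal{V}al$ and $\vDash_{\mathcal{M},\rho}(\exists\vec{x}.\varphi)\sigma$ for all $\rho$. An existentially constrained term $\Pi X.\, s\ [\exists\vec{x}.\,\varphi]$ is a triple of a set $X$ of variables, a term $s$ and an existential constraint with $\mathcal{FV}ar(\exists\vec{x}.\varphi)\subseteq X\subseteq\mathcal{V}ar(s)$ and $\{\vec{x}\}\cap\mathcal{V}ar(s)=\emptyset$. $\Pi X.\, s\ [\exists\vec{x}.\varphi]$ is subsumed by $\Pi Y.\, t\ [\exists\vec{y}.\psi]$ if for every $X$-valued substitution $\sigma$ with $\sigma\vDash_{\mathcal{M}}\exists\vec{x}.\varphi$ there is a $Y$-valued substitution $\gamma$ with $\gamma\vDash_{\mathcal{M}}\exists\vec{y}.\psi$ and $s\sigma=t\gamma$; the two are equivalent ($\sim$) if each is subsumed by the other. PG-transformation: $\mathrm{PG}(\Pi X.\, s\ [\exists\vec{x}.\varphi])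 = \Pi Y.\, t\ [\exists\vec{y}.\psi]$ where $\{p_1,\dots,p_n\}=\mathcal{P}os_{X\cup\mathcal{V}al}(s)$, $w_1,\dots,w_n$ are pairwise distinct fresh variables (of the sorts of $s|_{p_i}$), $Y=\{w_1,\dots,w_n\}$, $t=s[w_1,\dots,w_n]_{p_1,\dots,p_n}$, $\{\vec{y}\}=\{\vec{x}\}\cup X$, and $\psi=\varphi\wedge\bigwedge_{i=1}^n(s|_{p_i}=w_i)$. -}

module Defs where

open import Data.Bool using (Bool; true; false; T; _∧_)
open import Data.Nat using (ℕ; zero; suc)
open import Data.List using (List; []; _∷_; map; filter; _++_)
open import Data.List.Relation.Unary.All using (All; []; _∷_)
open import Data.List.Relation.Unary.Unique.Propositional using (Unique)
open import Data.List.Relation.Binary.Subset.Propositional using (_⊆_)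
open import Data.List.Membership.Propositional using (_∈_; _∉_)
import Data.List.Membership.DecPropositional as DecMem
open import Data.Maybe using (Maybe; just; nothing)
open import Data.Product using (Σ; _×_; _,_; Σ-syntax)
open import Data.Sum using (_⊎_)
open import Data.Empty using (⊥)
open import Relation.Binary.PropositionalEquality using (_≡_; _≢_)
open import Relation.Binary.Definitions using (DecidableEquality)
open import Relation.Nullary using (yes; no; ¬?)
open import Relation.Nullary.Decidable.Core using (T?)
open import Function.Bundles using (_⇔_)

record Setting : Set₁ where
  field
    Sort     : Set
    isThS    : Sort → Bool
    Fun      : List Sort → Sort → Set
    isThF    : ∀ {as r} → Fun as r → Bool
    th-sorts : ∀ {as r} (f : Fun as r) → T (isThF f) →
               All (λ S → T (isThS S)) as × T (isThS r)
    Var      : Set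
    sortV    : Var → Sort
    _≟V_     : DecidableEquality Var
    ⟦_⟧      : Sort → Set
    inhabited : ∀ S → T (isThS S) → ⟦ S ⟧
    ⟦_⟧f     : ∀ {as r} (f : Fun as r) → T (isThF f) → All ⟦_⟧ as → ⟦ r ⟧
    -- every element of a theory sort is a constant (theory) symbol: a value,
    -- interpreted as itself
    val      : (S : Sort) → T (isThS S) → ⟦ S ⟧ → Fun [] S
    val-th   : ∀ S h v → T (isThF (val S h v))
    val-sem  : ∀ S h v → ⟦ val S h v ⟧f (val-th S h v) [] ≡ v
    BoolS    : Sort
    BoolS-th : T (isThS BoolS)
    tt ff    : ⟦ BoolS ⟧
    tt≢ff    : tt ≢ ff
    bool-cases : ∀ (b : ⟦ BoolS ⟧) → b ≡ tt ⊎ b ≡ ff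
    and      : Fun (BoolS ∷ BoolS ∷ []) BoolS
    and-th   : T (isThF and)
    and-sem  : ∀ a b → (⟦ and ⟧f and-th (a ∷ b ∷ []) ≡ tt) ⇔ (a ≡ tt × b ≡ tt)
    eq       : (S : Sort) → T (isThS S) → Fun (S ∷ S ∷ []) BoolS
    eq-th    : ∀ S h → T (isThF (eq S h))
    eq-sem   : ∀ S h a b → (⟦ eq S h ⟧f (eq-th S h) (a ∷ b ∷ []) ≡ tt) ⇔ (a ≡ b)

module _ (𝒮 : Setting) where
  open Setting 𝒮
  open DecMem _≟V_ using (_∈?_)

  infixr 5 _∷ₜ_
  mutual
    data Term : Sort → Set where
      var : (x : Var) → Term (sortV x)
      app : ∀ {as r} → Fun as r → Terms as → Term r

    data Terms : List Sort → Set where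
      nil  : Terms []
      _∷ₜ_ : ∀ {S Ss} → Term S → Terms Ss → Terms (S ∷ Ss)

  mutual
    vars : ∀ {S} → Term S → List Var
    vars (var x)    = x ∷ []
    vars (app f ts) = varsL ts

    varsL : ∀ {Ss} → Terms Ss → List Var
    varsL nil       = []
    varsL (t ∷ₜ ts) = vars t ++ varsL ts

  Subst : Set
  Subst = (x : Var) → Term (sortV x)

  mutual
    _⟪_⟫ : ∀ {S} → Term S → Subst → Term S
    var x    ⟪ σ ⟫ = σ x
    app f ts ⟪ σ ⟫ = app f (ts ⟪ σ ⟫L)

    _⟪_⟫L : ∀ {Ss} → Terms Ss → Subst → Terms Ss
    nil       ⟪ σ ⟫L = nil
    (t ∷ₜ ts) ⟪ σ ⟫L = (t ⟪ σ ⟫) ∷ₜ (ts ⟪ σ ⟫L)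

  restrict : Subst → List Var → Subst
  restrict σ U x with x ∈? U
  ... | yes _ = σ x
  ... | no  _ = var x

  IsValSym : ∀ {as r} → Fun as r → Set
  IsValSym {as} {r} f =
    Σ[ h ∈ T (isThS r) ] Σ[ v ∈ ⟦ r ⟧ ]
      _≡_ {A = Σ (List Sort) (λ bs → Fun bs r)} (as , f) ([] , val r h v)

  IsValue : ∀ {S} → Term S → Set
  IsValue (var x)    = ⊥
  IsValue (app f ts) = IsValSym f

  Valued : Subst → List Var → Set
  Valued σ U = ∀ x → x ∈ U → IsValue (σ x)

  mutual
    thSyms : ∀ {S} → Term S → Bool
    thSyms (var x)    = true
    thSyms (app f ts) = isThF f ∧ thSymsL ts

    thSymsL : ∀ {Ss} → Terms Ss → Bool
    thSymsL nil       = true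
    thSymsL (t ∷ₜ ts) = thSyms t ∧ thSymsL ts

  IsLC : Term BoolS → Set
  IsLC φ = T (thSyms φ)

  Valuation : Set
  Valuation = (x : Var) → T (isThS (sortV x)) → ⟦ sortV x ⟧

  mutual
    eval : Valuation → ∀ {S} → Term S → Maybe ⟦ S ⟧
    eval ρ (var x) with T? (isThS (sortV x))
    ... | yes h = just (ρ x h)
    ... | no  _ = nothing
    eval ρ (app f ts) with T? (isThF f) | evalL ρ ts
    ... | yes h | just vs = just (⟦ f ⟧f h vs)
    ... | _     | _       = nothing

    evalL : Valuation → ∀ {Ss} → Terms Ss → Maybe (All ⟦_⟧ Ss)
    evalL ρ nil = just []
    evalL ρ (t ∷ₜ ts) with eval ρ t | evalL ρ ts
    ... | just v | just vs = just (v ∷ vs)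
    ... | _      | _       = nothing

  _⊨_ : Valuation → Term BoolS → Set
  ρ ⊨ φ = eval ρ φ ≡ just tt

  record ExC : Set where
    constructor ∃⟨_⟩_
    field
      bnd : List Var
      con : Term BoolS
  open ExC

  FV : ExC → List Var
  FV c = filter (λ v → ¬? (v ∈? bnd c)) (vars (con c))

  _⟪_⟫∃ : ExC → Subst → ExC
  c ⟪ σ ⟫∃ = ∃⟨ bnd c ⟩ (con c ⟪ restrict σ (FV c) ⟫)

  _⊨∃_ : Valuation → ExC → Set
  ρ ⊨∃ c = Σ[ θ ∈ Subst ] Valued θ (bnd c) × (ρ ⊨ (con c ⟪ restrict θ (bnd c) ⟫))

  _⊨ₛ_ : Subst → ExC → Set
  σ ⊨ₛ c = Valued σ (FV c) × (∀ ρ → ρ ⊨∃ (c ⟪ σ ⟫∃))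

  record CTerm (S : Sort) : Set where
    constructor Π_∙_[_]
    field
      X   : List Var
      trm : Term S
      exc : ExC
  open CTerm

  IsECT : ∀ {S} → CTerm S → Set
  IsECT A =
      IsLC (con (exc A))
    × (bnd (exc A) ⊆ vars (con (exc A)))
    × (FV (exc A) ⊆ X A)
    × (X A ⊆ vars (trm A))
    × (∀ x → x ∈ bnd (exc A) → x ∉ vars (trm A))

  _⊑_ : ∀ {S} → CTerm S → CTerm S → Set
  A ⊑ B = ∀ (σ : Subst) → Valued σ (X A) → σ ⊨ₛ exc A →
          Σ[ γ ∈ Subst ] Valued γ (X B) × (γ ⊨ₛ exc B) × (trm A ⟪ σ ⟫ ≡ trm B ⟪ γ ⟫)

  _∼_ : ∀ {S} → CTerm S → CTerm S → Set
  A ∼ B = (A ⊑ B) × (B ⊑ A)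

  Pos : Set
  Pos = List ℕ

  mutual
    _∣_ : ∀ {S} → Term S → Pos → Maybe (Σ Sort Term)
    t        ∣ []      = just (_ , t)
    var x    ∣ (i ∷ p) = nothing
    app f ts ∣ (i ∷ p) = subL ts i p

    subL : ∀ {Ss} → Terms Ss → ℕ → Pos → Maybe (Σ Sort Term)
    subL nil       i       p = nothing
    subL (t ∷ₜ ts) zero    p = t ∣ p
    subL (t ∷ₜ ts) (suc i) p = subL ts i p

  RootIn : List Var → Σ Sort Term → Set
  RootIn U (_ , var x)    = x ∈ U
  RootIn U (_ , app f ts) = IsValSym f

  PosIn : ∀ {S} → List Var → Term S → Pos → Set
  PosIn U s p = Σ[ u ∈ Σ Sort Term ] (s ∣ p ≡ just u) × RootIn U u

  mutual
    data Repl : ∀ {S} → Term S → Pos → ∀ {S'} → Term S' → Term S → Set where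
      here  : ∀ {S} {t u : Term S} → Repl t [] u u
      under : ∀ {as r} {f : Fun as r} {ts ts' : Terms as} {i p S'} {u : Term S'} →
              ReplL ts i p u ts' → Repl (app f ts) (i ∷ p) u (app f ts')

    data ReplL : ∀ {Ss} → Terms Ss → ℕ → Pos → ∀ {S'} → Term S' → Terms Ss → Set where
      hd : ∀ {S Ss} {t t' : Term S} {ts : Terms Ss} {p S'} {u : Term S'} →
           Repl t p u t' → ReplL (t ∷ₜ ts) zero p u (t' ∷ₜ ts)
      tl : ∀ {S Ss} {t : Term S} {ts ts' : Terms Ss} {i p S'} {u : Term S'} →
           ReplL ts i p u ts' → ReplL (t ∷ₜ ts) (suc i) p u (t ∷ₜ ts')

  -- one entry (p_i , w_i , s|_{p_i}) of the PG-transformation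
  record Entry : Set where
    constructor entry
    field
      pos : Pos
      fv  : Var
      sub : Term (sortV fv)
  open Entry

  -- s[w_1,…,w_n]_{p_1,…,p_n} (for parallel positions, done one after another)
  data ReplAll {S} : Term S → List Entry → Term S → Set where
    done : ∀ {t} → ReplAll t [] t
    step : ∀ {t t' t'' e es} → Repl t (pos e) (var (fv e)) t' →
           ReplAll t' es t'' → ReplAll t (e ∷ es) t''

  _∧ₜ_ : Term BoolS → Term BoolS → Term BoolS
  φ ∧ₜ ψ = app and (φ ∷ₜ ψ ∷ₜ nil)

  eqAt : (e : Entry) → T (isThS (sortV (fv e))) → Term BoolS
  eqAt e h = app (eq (sortV (fv e)) h) (sub e ∷ₜ var (fv e) ∷ₜ nil)

  ⋀ : (es : List Entry) → All (λ e → T (isThS (sortV (fv e)))) es → Term BoolS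
  ⋀ []       []       = app (val BoolS BoolS-th tt) nil
  ⋀ (e ∷ es) (h ∷ hs) = eqAt e h ∧ₜ ⋀ es hs

  IsPG : ∀ {S} → CTerm S → CTerm S → Set
  IsPG A B =
    Σ[ es ∈ List Entry ]
        Unique (map pos es)
      × (∀ p → (p ∈ map pos es) ⇔ PosIn (X A) (trm A) p)
      × All (λ e → trm A ∣ pos e ≡ just (sortV (fv e) , sub e)) es
      × Unique (map fv es)
      × All (λ e → fv e ∉ vars (trm A) × fv e ∉ vars (con (exc A))
                 × fv e ∉ bnd (exc A) × fv e ∉ X A) es
      × (∀ v → (v ∈ X B) ⇔ (v ∈ map fv es))
      × ReplAll (trm A) es (trm B)
      × (∀ v → (v ∈ bnd (exc B)) ⇔ (v ∈ bnd (exc A) ⊎ v ∈ X A))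
      × (Σ[ hs ∈ All (λ e → T (isThS (sortV (fv e)))) es ]
           con (exc B) ≡ (con (exc A) ∧ₜ ⋀ es hs))

{-# OPTIONS --safe #-}
module Submission where

-- Write the PG-form as Π Y. t [∃ys. ψ] with ψ = φ ∧ ⋀ᵢ (s|pᵢ = wᵢ). An instance σ of
-- Π X. s [∃xs. φ] yields the instance σ[wᵢ ↦ s|pᵢσ] of the PG-form, and a witness θ for xs,
-- extended by σ on X, witnesses ys = xs ∪ X. Conversely, a witness θ for ys under an instance γ
-- forces s|pᵢθ = γ(wᵢ), so θ on X (γ elsewhere) is an instance of Π X. s [∃xs. φ] with the same
-- term. Both computations use that instantiating ∃bs. c by σ and then by a witness θ is the single
-- substitution "θ on bs, σ elsewhere", since σ is valued on the free variables.

open import Defs hiding (_⟪_⟫; _⟪_⟫L; _⟪_⟫∃; _⊨_; _⊨∃_; _⊑_; _∣_; _∧ₜ_)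
import Defs as D
open import Data.Bool using (T)
open import Data.Bool.Properties using (T-irrelevant)
open import Data.List using (List; []; _∷_; map)
open import Data.List.Properties using (++-identityʳ)
open import Data.List.Relation.Unary.All as All using (All; []; _∷_)
open import Data.List.Relation.Unary.All.Properties using (map⁻)
open import Data.List.Relation.Unary.Any using (here; there)
open import Data.List.Relation.Unary.AllPairs using (_∷_)
open import Data.List.Relation.Unary.Unique.Propositional using (Unique)
open import Data.List.Relation.Binary.Subset.Propositional using (_⊆_)
open import Data.List.Membership.Propositional using (_∈_; _∉_)
open import Data.List.Membership.Propositional.Properties
  using (∈-++⁺ˡ; ∈-++⁺ʳ; ∈-++⁻; ∈-map⁺; ∈-map⁻; ∈-filter⁺; ∈-filter⁻)
import Data.List.Membership.DecPropositional as DecMembership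
open import Data.Maybe as Maybe using (Maybe; just; nothing)
open import Data.Maybe.Properties using (just-injective)
open import Data.Nat using (zero; suc)
open import Data.Product using (Σ; ∃-syntax; _×_; _,_; proj₁; proj₂)
open import Data.Sum as Sum using (_⊎_; inj₁; inj₂)
open import Function.Base using (_∘_)
open import Function.Bundles using (_⇔_; mk⇔; Equivalence)
open import Relation.Binary.PropositionalEquality
  using (_≡_; _≢_; refl; sym; trans; cong; cong₂; subst; module ≡-Reasoning)
open import Relation.Nullary using (yes; no; ¬?; contradiction)
open import Relation.Nullary.Decidable.Core using (T?)

module Properties (𝒮 : Setting) where
  open Setting 𝒮
  open DecMembership _≟V_ using (_∈?_)
  open Equivalence using (to; from)
  open Entry
  open ExC

  infixl 8 _⟪_⟫ _⟪_⟫L _⟪_⟫∃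
  infix  4 _⊨_ _⊨∃_ _⊑_
  infixr 6 _∧ₜ_

  _⟪_⟫ : ∀ {S} → Term 𝒮 S → Subst 𝒮 → Term 𝒮 S
  _⟪_⟫ = D._⟪_⟫ 𝒮

  _⟪_⟫L : ∀ {Ss} → Terms 𝒮 Ss → Subst 𝒮 → Terms 𝒮 Ss
  _⟪_⟫L = D._⟪_⟫L 𝒮

  _⟪_⟫∃ : ExC 𝒮 → Subst 𝒮 → ExC 𝒮
  _⟪_⟫∃ = D._⟪_⟫∃ 𝒮

  _⊨_ : Valuation 𝒮 → Term 𝒮 BoolS → Set
  _⊨_ = D._⊨_ 𝒮

  _⊨∃_ : Valuation 𝒮 → ExC 𝒮 → Set
  _⊨∃_ = D._⊨∃_ 𝒮

  _⊑_ : ∀ {S} → CTerm 𝒮 S → CTerm 𝒮 S → Set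
  _⊑_ = D._⊑_ 𝒮

  _∣_ : ∀ {S} → Term 𝒮 S → Pos 𝒮 → Maybe (Σ Sort (Term 𝒮))
  _∣_ = D._∣_ 𝒮

  _∧ₜ_ : Term 𝒮 BoolS → Term 𝒮 BoolS → Term 𝒮 BoolS
  _∧ₜ_ = D._∧ₜ_ 𝒮

  private variable
    S S′ : Sort
    Ss : List Sort
    x : Var
    U : List Var
    σ τ θ : Subst 𝒮
    ρ ρ′ : Valuation 𝒮

  restrict-∈ : x ∈ U → restrict 𝒮 σ U x ≡ σ x
  restrict-∈ {x = x} {U = U} x∈U with x ∈? U
  ... | yes _   = refl
  ... | no  x∉U = contradiction x∈U x∉U

  restrict-∉ : x ∉ U → restrict 𝒮 σ U x ≡ var x
  restrict-∉ {x = x} {U = U} x∉U with x ∈? U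
  ... | yes x∈U = contradiction x∈U x∉U
  ... | no  _   = refl

  override : List Var → Subst 𝒮 → Subst 𝒮 → Subst 𝒮
  override U τ σ x with x ∈? U
  ... | yes _ = τ x
  ... | no  _ = σ x

  override-∈ : x ∈ U → override U τ σ x ≡ τ x
  override-∈ {x = x} {U = U} x∈U with x ∈? U
  ... | yes _   = refl
  ... | no  x∉U = contradiction x∈U x∉U

  override-∉ : x ∉ U → override U τ σ x ≡ σ x
  override-∉ {x = x} {U = U} x∉U with x ∈? U
  ... | yes x∈U = contradiction x∈U x∉U
  ... | no  _   = refl

  _⨾_ : Subst 𝒮 → Subst 𝒮 → Subst 𝒮
  (σ ⨾ τ) x = σ x ⟪ τ ⟫

  ⟪⟫-cong : (t : Term 𝒮 S) → (∀ x → x ∈ vars 𝒮 t → σ x ≡ τ x) → t ⟪ σ ⟫ ≡ t ⟪ τ ⟫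
  ⟪⟫L-cong : (ts : Terms 𝒮 Ss) → (∀ x → x ∈ varsL 𝒮 ts → σ x ≡ τ x) → ts ⟪ σ ⟫L ≡ ts ⟪ τ ⟫L
  ⟪⟫-cong (var x)    σ≗τ = σ≗τ x (here refl)
  ⟪⟫-cong (app f ts) σ≗τ = cong (app f) (⟪⟫L-cong ts σ≗τ)
  ⟪⟫L-cong nil       σ≗τ = refl
  ⟪⟫L-cong (t ∷ₜ ts) σ≗τ =
    cong₂ _∷ₜ_ (⟪⟫-cong t (λ x → σ≗τ x ∘ ∈-++⁺ˡ)) (⟪⟫L-cong ts (λ x → σ≗τ x ∘ ∈-++⁺ʳ _))

  ⟪⟫-⨾ : (t : Term 𝒮 S) → t ⟪ σ ⟫ ⟪ τ ⟫ ≡ t ⟪ σ ⨾ τ ⟫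
  ⟪⟫L-⨾ : (ts : Terms 𝒮 Ss) → ts ⟪ σ ⟫L ⟪ τ ⟫L ≡ ts ⟪ σ ⨾ τ ⟫L
  ⟪⟫-⨾ (var x)    = refl
  ⟪⟫-⨾ (app f ts) = cong (app f) (⟪⟫L-⨾ ts)
  ⟪⟫L-⨾ nil       = refl
  ⟪⟫L-⨾ (t ∷ₜ ts) = cong₂ _∷ₜ_ (⟪⟫-⨾ t) (⟪⟫L-⨾ ts)

  ∈-vars-⟪⟫⁻ : (t : Term 𝒮 S) → x ∈ vars 𝒮 (t ⟪ σ ⟫) → ∃[ y ] y ∈ vars 𝒮 t × x ∈ vars 𝒮 (σ y)
  ∈-varsL-⟪⟫⁻ : (ts : Terms 𝒮 Ss) → x ∈ varsL 𝒮 (ts ⟪ σ ⟫L) → ∃[ y ] y ∈ varsL 𝒮 ts × x ∈ vars 𝒮 (σ y)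
  ∈-vars-⟪⟫⁻ (var y)    x∈ = y , here refl , x∈
  ∈-vars-⟪⟫⁻ (app f ts) x∈ = ∈-varsL-⟪⟫⁻ ts x∈
  ∈-varsL-⟪⟫⁻ (t ∷ₜ ts) x∈ with ∈-++⁻ (vars 𝒮 (t ⟪ _ ⟫)) x∈
  ... | inj₁ x∈t  = let y , y∈ , x∈σy = ∈-vars-⟪⟫⁻ t x∈t in y , ∈-++⁺ˡ y∈ , x∈σy
  ... | inj₂ x∈ts = let y , y∈ , x∈σy = ∈-varsL-⟪⟫⁻ ts x∈ts in y , ∈-++⁺ʳ _ y∈ , x∈σy

  valueTerm : T (isThS S) → ⟦ S ⟧ → Term 𝒮 S
  valueTerm h v = app (val _ h v) nil

  IsValue⇒valueTerm : (t : Term 𝒮 S) → IsValue 𝒮 t → ∃[ h ] ∃[ v ] t ≡ valueTerm h v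
  IsValue⇒valueTerm (app _ nil) (h , v , refl) = h , v , refl

  value-⟪⟫ : (t : Term 𝒮 S) → IsValue 𝒮 t → t ⟪ σ ⟫ ≡ t
  value-⟪⟫ t t-val with IsValue⇒valueTerm t t-val
  ... | _ , _ , refl = refl

  ∉-vars-value : (t : Term 𝒮 S) → IsValue 𝒮 t → x ∉ vars 𝒮 t
  ∉-vars-value t t-val with IsValue⇒valueTerm t t-val
  ... | _ , _ , refl = λ ()

  ∉-vars-valued-⟪⟫ : (t : Term 𝒮 S) → Valued 𝒮 θ (vars 𝒮 t) → x ∉ vars 𝒮 (t ⟪ θ ⟫)
  ∉-vars-valued-⟪⟫ {θ = θ} t θ-val x∈ =
    let y , y∈t , x∈θy = ∈-vars-⟪⟫⁻ t x∈ in ∉-vars-value (θ y) (θ-val y y∈t) x∈θy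

  eval-app : ∀ ρ {as r} (f : Fun as r) (h : T (isThF f)) (ts : Terms 𝒮 as) →
             eval 𝒮 ρ (app f ts) ≡ Maybe.map (⟦ f ⟧f h) (evalL 𝒮 ρ ts)
  eval-app ρ f h ts with T? (isThF f) | evalL 𝒮 ρ ts
  ... | yes h′ | just vs = cong (λ h → just (⟦ f ⟧f h vs)) (T-irrelevant h′ h)
  ... | yes _  | nothing = refl
  ... | no ¬h  | _       = contradiction h ¬h

  eval-binary : ∀ ρ {S₁ S₂ r} (f : Fun (S₁ ∷ S₂ ∷ []) r) (h : T (isThF f))
                (a : Term 𝒮 S₁) (b : Term 𝒮 S₂) {v} →
                eval 𝒮 ρ (app f (a ∷ₜ b ∷ₜ nil)) ≡ just v ⇔
                (∃[ va ] ∃[ vb ] eval 𝒮 ρ a ≡ just va × eval 𝒮 ρ b ≡ just vb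
                                × ⟦ f ⟧f h (va ∷ vb ∷ []) ≡ v)
  eval-binary ρ f h a b rewrite eval-app ρ f h (a ∷ₜ b ∷ₜ nil) with eval 𝒮 ρ a | eval 𝒮 ρ b
  ... | just va | just vb = mk⇔ (λ e → va , vb , refl , refl , just-injective e)
                                (λ { (_ , _ , refl , refl , e) → cong just e })
  ... | just _  | nothing = mk⇔ (λ ()) (λ { (_ , _ , _ , () , _) })
  ... | nothing | _       = mk⇔ (λ ()) (λ { (_ , _ , () , _) })

  eval-valueTerm : ∀ ρ (h : T (isThS S)) v → eval 𝒮 ρ (valueTerm h v) ≡ just v
  eval-valueTerm ρ h v = trans (eval-app ρ (val _ h v) (val-th _ h v) nil) (cong just (val-sem _ h v))

  eval-cong : (t : Term 𝒮 S) → (∀ x → x ∈ vars 𝒮 t → ∀ h → ρ x h ≡ ρ′ x h) → eval 𝒮 ρ t ≡ eval 𝒮 ρ′ t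
  evalL-cong : (ts : Terms 𝒮 Ss) → (∀ x → x ∈ varsL 𝒮 ts → ∀ h → ρ x h ≡ ρ′ x h) →
               evalL 𝒮 ρ ts ≡ evalL 𝒮 ρ′ ts
  eval-cong (var x) ρ≗ρ′ with T? (isThS (sortV x))
  ... | yes h = cong just (ρ≗ρ′ x (here refl) h)
  ... | no _  = refl
  eval-cong (app f ts) ρ≗ρ′ rewrite evalL-cong ts ρ≗ρ′ = refl
  evalL-cong nil ρ≗ρ′ = refl
  evalL-cong (t ∷ₜ ts) ρ≗ρ′
    rewrite eval-cong t (λ x → ρ≗ρ′ x ∘ ∈-++⁺ˡ) | evalL-cong ts (λ x → ρ≗ρ′ x ∘ ∈-++⁺ʳ _) = refl

  ⊨-valued-⟪⟫ : (φ : Term 𝒮 BoolS) → Valued 𝒮 θ (vars 𝒮 φ) → ρ ⊨ φ ⟪ θ ⟫ → ρ′ ⊨ φ ⟪ θ ⟫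
  ⊨-valued-⟪⟫ φ θ-val ρ⊨ =
    trans (eval-cong (φ ⟪ _ ⟫) (λ x x∈ → contradiction x∈ (∉-vars-valued-⟪⟫ φ θ-val))) ρ⊨

  ⊨-∧ₜ : (φ ψ : Term 𝒮 BoolS) → ρ ⊨ φ ∧ₜ ψ ⇔ (ρ ⊨ φ × ρ ⊨ ψ)
  ⊨-∧ₜ {ρ = ρ} φ ψ = mk⇔
    (λ ⊨φ∧ψ → let _ , _ , ⊨φ , ⊨ψ , and≡tt = to (eval-binary ρ and and-th φ ψ) ⊨φ∧ψ
                  va≡tt , vb≡tt = to (and-sem _ _) and≡tt
              in trans ⊨φ (cong just va≡tt) , trans ⊨ψ (cong just vb≡tt))
    (λ (⊨φ , ⊨ψ) → from (eval-binary ρ and and-th φ ψ)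
                          (tt , tt , ⊨φ , ⊨ψ , from (and-sem tt tt) (refl , refl)))

  ⊨-eq⇔≡ : (h : T (isThS S)) (a b : Term 𝒮 S) → IsValue 𝒮 a → IsValue 𝒮 b →
           ρ ⊨ app (eq S h) (a ∷ₜ b ∷ₜ nil) ⇔ a ≡ b
  ⊨-eq⇔≡ {ρ = ρ} h a b a-val b-val
    with IsValue⇒valueTerm a a-val | IsValue⇒valueTerm b b-val
  ... | ha , va , refl | hb , vb , refl = mk⇔
    (λ ⊨eq → let va′ , vb′ , ea , eb , eq≡tt = to (⊨eq⇔ a b) ⊨eq
                 va≡va′ = just-injective (trans (sym (eval-valueTerm ρ ha va)) ea)
                 vb≡vb′ = just-injective (trans (sym (eval-valueTerm ρ hb vb)) eb)
                 va′≡vb′ = to (eq-sem _ h va′ vb′) eq≡tt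
             in cong₂ valueTerm (T-irrelevant ha hb) (trans va≡va′ (trans va′≡vb′ (sym vb≡vb′))))
    (λ a≡b → subst (λ b → ρ ⊨ app (eq _ h) (a ∷ₜ b ∷ₜ nil)) a≡b
               (from (⊨eq⇔ a a) (va , va , eval-valueTerm ρ ha va , eval-valueTerm ρ ha va ,
                                  from (eq-sem _ h va va) refl)))
    where
    ⊨eq⇔ = eval-binary ρ (eq _ h) (eq-th _ h)

  ∈-vars-∧ₜ⁻ : (φ ψ : Term 𝒮 BoolS) → x ∈ vars 𝒮 (φ ∧ₜ ψ) → x ∈ vars 𝒮 φ ⊎ x ∈ vars 𝒮 ψ
  ∈-vars-∧ₜ⁻ φ ψ x∈ = Sum.map₂ (subst (_ ∈_) (++-identityʳ (vars 𝒮 ψ))) (∈-++⁻ (vars 𝒮 φ) x∈)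

  ⊨-⋀ : ∀ es (hs : All (λ e → T (isThS (sortV (fv e)))) es) →
        ρ ⊨ ⋀ 𝒮 es hs ⟪ τ ⟫ ⇔ (∀ {e} (h : T (isThS (sortV (fv e)))) → e ∈ es → ρ ⊨ eqAt 𝒮 e h ⟪ τ ⟫)
  ⊨-⋀ {ρ = ρ} [] [] = mk⇔ (λ _ {_} _ ()) (λ _ → eval-valueTerm ρ BoolS-th tt)
  ⊨-⋀ {τ = τ} (e ∷ es) (h ∷ hs) = mk⇔
    (λ ⊨⋀ → let ⊨e , ⊨es = to ⊨∧⇔ ⊨⋀ in λ where
       h′ (here refl) → subst (λ h → _ ⊨ eqAt 𝒮 e h ⟪ τ ⟫) (T-irrelevant h h′) ⊨e
       h′ (there e′∈) → to (⊨-⋀ es hs) ⊨es h′ e′∈)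
    (λ ⊨all → from ⊨∧⇔ (⊨all h (here refl) , from (⊨-⋀ es hs) (λ h′ → ⊨all h′ ∘ there)))
    where
    ⊨∧⇔ = ⊨-∧ₜ (eqAt 𝒮 e h ⟪ τ ⟫) (⋀ 𝒮 es hs ⟪ τ ⟫)

  ∈-vars-⋀⁻ : ∀ es (hs : All (λ e → T (isThS (sortV (fv e)))) es) → x ∈ vars 𝒮 (⋀ 𝒮 es hs) →
              ∃[ e ] e ∈ es × (x ∈ vars 𝒮 (sub e) ⊎ x ≡ fv e)
  ∈-vars-⋀⁻ (e ∷ es) (h ∷ hs) x∈ with ∈-vars-∧ₜ⁻ (eqAt 𝒮 e h) (⋀ 𝒮 es hs) x∈
  ... | inj₂ x∈⋀ = let e′ , e′∈ , x∈e′ = ∈-vars-⋀⁻ es hs x∈⋀ in e′ , there e′∈ , x∈e′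
  ... | inj₁ x∈eq with ∈-++⁻ (vars 𝒮 (sub e)) x∈eq
  ...   | inj₁ x∈sub       = e , here refl , inj₁ x∈sub
  ...   | inj₂ (here x≡fv) = e , here refl , inj₂ x≡fv

  ∈-FV⁺ : (c : ExC 𝒮) → x ∈ vars 𝒮 (con c) → x ∉ bnd c → x ∈ FV 𝒮 c
  ∈-FV⁺ c = ∈-filter⁺ (λ v → ¬? (v ∈? bnd c))

  ∈-FV⁻ : (c : ExC 𝒮) → x ∈ FV 𝒮 c → x ∈ vars 𝒮 (con c) × x ∉ bnd c
  ∈-FV⁻ c = ∈-filter⁻ (λ v → ¬? (v ∈? bnd c))

  -- The values substituted for the free variables are left alone by the second substitution.
  ⟪restrict⟫-⟪restrict⟫ : (c : ExC 𝒮) → Valued 𝒮 σ (FV 𝒮 c) →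
    con c ⟪ restrict 𝒮 σ (FV 𝒮 c) ⟫ ⟪ restrict 𝒮 θ (bnd c) ⟫ ≡ con c ⟪ override (bnd c) θ σ ⟫
  ⟪restrict⟫-⟪restrict⟫ {σ = σ} {θ = θ} c σ-val =
    trans (⟪⟫-⨾ (con c)) (⟪⟫-cong (con c) pointwise)
    where
    pointwise : ∀ x → x ∈ vars 𝒮 (con c) → restrict 𝒮 σ (FV 𝒮 c) x ⟪ restrict 𝒮 θ (bnd c) ⟫
                                          ≡ override (bnd c) θ σ x
    pointwise x x∈c with x ∈? bnd c
    ... | yes x∈bnd
      rewrite restrict-∉ {σ = σ} (λ x∈FV → proj₂ (∈-FV⁻ c x∈FV) x∈bnd)
            | restrict-∈ {σ = θ} x∈bnd = refl
    ... | no x∉bnd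
      rewrite restrict-∈ {σ = σ} (∈-FV⁺ c x∈c x∉bnd) =
        value-⟪⟫ (σ x) (σ-val x (∈-FV⁺ c x∈c x∉bnd))

  ⊨∃-⟪⟫∃ : (c : ExC 𝒮) → Valued 𝒮 σ (FV 𝒮 c) →
           ρ ⊨∃ c ⟪ σ ⟫∃ ⇔ (∃[ θ ] Valued 𝒮 θ (bnd c) × ρ ⊨ con c ⟪ override (bnd c) θ σ ⟫)
  ⊨∃-⟪⟫∃ {ρ = ρ} c σ-val = mk⇔
    (λ (θ , θ-val , ⊨c) → θ , θ-val , subst (ρ ⊨_) (⟪restrict⟫-⟪restrict⟫ c σ-val) ⊨c)
    (λ (θ , θ-val , ⊨c) → θ , θ-val , subst (ρ ⊨_) (sym (⟪restrict⟫-⟪restrict⟫ c σ-val)) ⊨c)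

  data IsLeaf : Term 𝒮 S → Set where
    leaf-var   : ∀ x → IsLeaf (var x)
    leaf-const : ∀ {r} (c : Fun [] r) → IsLeaf (app c nil)

  RootIn⇒IsLeaf : (t : Term 𝒮 S) → RootIn 𝒮 U (S , t) → IsLeaf t
  RootIn⇒IsLeaf (var x)     _             = leaf-var x
  RootIn⇒IsLeaf (app _ nil) (_ , _ , refl) = leaf-const _

  RootIn-valued : (t : Term 𝒮 S) → RootIn 𝒮 U (S , t) → Valued 𝒮 σ U → IsValue 𝒮 (t ⟪ σ ⟫)
  RootIn-valued (var x)    x∈U   σ-val = σ-val x x∈U
  RootIn-valued {σ = σ} (app f ts) t-val _ =
    subst (IsValue 𝒮) (sym (value-⟪⟫ {σ = σ} (app f ts) t-val)) t-val

  RootIn-vars : (t : Term 𝒮 S) → RootIn 𝒮 U (S , t) → x ∈ vars 𝒮 t → x ∈ U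
  RootIn-vars (var x)    x∈U   (here refl) = x∈U
  RootIn-vars (app f ts) t-val x∈          = contradiction x∈ (∉-vars-value (app f ts) t-val)

  ∈-vars⇒∣ : (t : Term 𝒮 S) → x ∈ vars 𝒮 t → ∃[ q ] t ∣ q ≡ just (sortV x , var x)
  ∈-varsL⇒subL : (ts : Terms 𝒮 Ss) → x ∈ varsL 𝒮 ts → ∃[ i ] ∃[ q ] subL 𝒮 ts i q ≡ just (sortV x , var x)
  ∈-vars⇒∣ (var y)    (here refl) = [] , refl
  ∈-vars⇒∣ (app f ts) x∈          = let i , q , ts∣iq = ∈-varsL⇒subL ts x∈ in i ∷ q , ts∣iq
  ∈-varsL⇒subL (t ∷ₜ ts) x∈ with ∈-++⁻ (vars 𝒮 t) x∈
  ... | inj₁ x∈t  = let q , t∣q = ∈-vars⇒∣ t x∈t in zero , q , t∣q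
  ... | inj₂ x∈ts = let i , q , ts∣iq = ∈-varsL⇒subL ts x∈ts in suc i , q , ts∣iq

  module _ {S′} {u : Term 𝒮 S′} where

    Repl-∣-here : ∀ {t t′ : Term 𝒮 S} {p} → Repl 𝒮 t p u t′ → t′ ∣ p ≡ just (S′ , u)
    ReplL-subL-here : ∀ {ts ts′ : Terms 𝒮 Ss} {i p} → ReplL 𝒮 ts i p u ts′ →
                      subL 𝒮 ts′ i p ≡ just (S′ , u)
    Repl-∣-here here      = refl
    Repl-∣-here (under r) = ReplL-subL-here r
    ReplL-subL-here (hd r) = Repl-∣-here r
    ReplL-subL-here (tl r) = ReplL-subL-here r

    Repl-⟪⟫ : ∀ {t t′ : Term 𝒮 S} {p} {w : Term 𝒮 S′} → Repl 𝒮 t p u t′ → t ∣ p ≡ just (S′ , w) →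
              u ⟪ τ ⟫ ≡ w ⟪ τ ⟫ → t′ ⟪ τ ⟫ ≡ t ⟪ τ ⟫
    ReplL-⟪⟫ : ∀ {ts ts′ : Terms 𝒮 Ss} {i p} {w : Term 𝒮 S′} → ReplL 𝒮 ts i p u ts′ →
               subL 𝒮 ts i p ≡ just (S′ , w) → u ⟪ τ ⟫ ≡ w ⟪ τ ⟫ → ts′ ⟪ τ ⟫L ≡ ts ⟪ τ ⟫L
    Repl-⟪⟫ here      refl uτ≡wτ = uτ≡wτ
    Repl-⟪⟫ (under r) t∣p  uτ≡wτ = cong (app _) (ReplL-⟪⟫ r t∣p uτ≡wτ)
    ReplL-⟪⟫ (hd r) t∣p uτ≡wτ = cong (_∷ₜ _) (Repl-⟪⟫ r t∣p uτ≡wτ)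
    ReplL-⟪⟫ (tl r) t∣p uτ≡wτ = cong (_ ∷ₜ_) (ReplL-⟪⟫ r t∣p uτ≡wτ)

    -- Distinct positions holding leaves are parallel, so replacing at one keeps the other.
    Repl-∣-other : ∀ {t t′ : Term 𝒮 S} {p q S₁ S₂} {a : Term 𝒮 S₁} {b : Term 𝒮 S₂} →
                   Repl 𝒮 t p u t′ → t ∣ p ≡ just (S₁ , a) → IsLeaf a →
                   t ∣ q ≡ just (S₂ , b) → IsLeaf b → p ≢ q → t′ ∣ q ≡ just (S₂ , b)
    ReplL-subL-other : ∀ {ts ts′ : Terms 𝒮 Ss} {i p j q S₁ S₂} {a : Term 𝒮 S₁} {b : Term 𝒮 S₂} →
                       ReplL 𝒮 ts i p u ts′ → subL 𝒮 ts i p ≡ just (S₁ , a) → IsLeaf a →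
                       subL 𝒮 ts j q ≡ just (S₂ , b) → IsLeaf b → i ∷ p ≢ j ∷ q →
                       subL 𝒮 ts′ j q ≡ just (S₂ , b)
    Repl-∣-other {q = []}    here refl _                _  _ p≢q = contradiction refl p≢q
    Repl-∣-other {q = _ ∷ _} here refl (leaf-var _)     () _ _
    Repl-∣-other {q = _ ∷ _} here refl (leaf-const _)   () _ _
    Repl-∣-other {q = []}    (under r) () _ refl (leaf-const _) _
    Repl-∣-other {q = j ∷ q} (under r) t∣p a-leaf t∣q b-leaf p≢q =
      ReplL-subL-other {j = j} {q = q} r t∣p a-leaf t∣q b-leaf p≢q
    ReplL-subL-other {j = zero} {q} (hd r) ts∣ip a-leaf ts∣jq b-leaf ip≢jq =
      Repl-∣-other {q = q} r ts∣ip a-leaf ts∣jq b-leaf (ip≢jq ∘ cong (zero ∷_))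
    ReplL-subL-other {j = suc _} (hd r) _ _ ts∣jq _ _ = ts∣jq
    ReplL-subL-other {j = zero}  (tl r) _ _ ts∣jq _ _ = ts∣jq
    ReplL-subL-other {j = suc j} {q} (tl r) ts∣ip a-leaf ts∣jq b-leaf ip≢jq =
      ReplL-subL-other {j = j} {q = q} r ts∣ip a-leaf ts∣jq b-leaf (λ { refl → ip≢jq refl })

  module _ {w : Var} where

    Repl-∣-var⁻ : ∀ {t t′ : Term 𝒮 S} {p q} → Repl 𝒮 t p (var w) t′ →
                  t′ ∣ q ≡ just (sortV x , var x) → x ≢ w → t ∣ q ≡ just (sortV x , var x)
    ReplL-subL-var⁻ : ∀ {ts ts′ : Terms 𝒮 Ss} {i p j q} → ReplL 𝒮 ts i p (var w) ts′ →
                      subL 𝒮 ts′ j q ≡ just (sortV x , var x) → x ≢ w →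
                      subL 𝒮 ts j q ≡ just (sortV x , var x)
    Repl-∣-var⁻ {q = []}    here      refl x≢w = contradiction refl x≢w
    Repl-∣-var⁻ {q = []}    (under r) ()   _
    Repl-∣-var⁻ {q = j ∷ q} (under r) t′∣q x≢w = ReplL-subL-var⁻ {j = j} {q = q} r t′∣q x≢w
    ReplL-subL-var⁻ {j = zero} {q} (hd r) ts′∣jq x≢w = Repl-∣-var⁻ {q = q} r ts′∣jq x≢w
    ReplL-subL-var⁻ {j = suc _} (hd r) ts′∣jq _   = ts′∣jq
    ReplL-subL-var⁻ {j = zero}  (tl r) ts′∣jq _   = ts′∣jq
    ReplL-subL-var⁻ {j = suc j} {q} (tl r) ts′∣jq x≢w = ReplL-subL-var⁻ {j = j} {q = q} r ts′∣jq x≢w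

  ReplAll-⟪⟫ : ∀ {t t′ : Term 𝒮 S} {es} → ReplAll 𝒮 t es t′ → Unique (map pos es) →
               All (λ e → t ∣ pos e ≡ just (sortV (fv e) , sub e)) es → All (IsLeaf ∘ sub) es →
               All (λ e → τ (fv e) ≡ sub e ⟪ τ ⟫) es → t′ ⟪ τ ⟫ ≡ t ⟪ τ ⟫
  ReplAll-⟪⟫ done _ _ _ _ = refl
  ReplAll-⟪⟫ (step r rs) (p∉ps ∷ ps-unique) (t∣p ∷ t∣ps) (leaf ∷ leaves) (τw≡ ∷ τws≡) =
    trans (ReplAll-⟪⟫ rs ps-unique t′∣ps leaves τws≡) (Repl-⟪⟫ r t∣p τw≡)
    where
    t′∣ps = All.tabulate λ {e} e∈ →
      Repl-∣-other {q = pos e} r t∣p leaf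
        (All.lookup t∣ps e∈) (All.lookup leaves e∈) (All.lookup (map⁻ p∉ps) e∈)

  ReplAll-∣-var⁻ : ∀ {t t′ : Term 𝒮 S} {es q} → ReplAll 𝒮 t es t′ →
                   t′ ∣ q ≡ just (sortV x , var x) → x ∉ map fv es →
                   t ∣ q ≡ just (sortV x , var x) × q ∉ map pos es
  ReplAll-∣-var⁻ done t∣q _ = t∣q , λ ()
  ReplAll-∣-var⁻ {x = x} {q = q} (step r rs) t′∣q x∉ws
    with ReplAll-∣-var⁻ {q = q} rs t′∣q (x∉ws ∘ there)
  ... | t₁∣q , q∉ps = Repl-∣-var⁻ {q = q} r t₁∣q (x∉ws ∘ here) , λ where
        (here refl) → x∉ws (here (var-injective (just-injective (trans (sym t₁∣q) (Repl-∣-here r)))))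
        (there q∈)  → q∉ps q∈
    where
    var-injective : ∀ {y} → _≡_ {A = Σ Sort (Term 𝒮)} (sortV x , var x) (sortV y , var y) → x ≡ y
    var-injective refl = refl

module PG (𝒮 : Setting) where
  open Setting 𝒮
  open DecMembership _≟V_ using (_∈?_)
  open Equivalence using (to; from)
  open Entry
  open Properties 𝒮

  private variable
    x : Var
    ρ : Valuation 𝒮

  extend : Subst 𝒮 → List (Entry 𝒮) → Subst 𝒮
  extend σ []       x = σ x
  extend σ (e ∷ es) x with fv e ≟V x
  ... | yes refl = sub e ⟪ σ ⟫
  ... | no  _    = extend σ es x

  extend-∉ : ∀ {σ} es → x ∉ map fv es → extend σ es x ≡ σ x
  extend-∉     []       _    = refl
  extend-∉ {x} (e ∷ es) x∉ws with fv e ≟V x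
  ... | yes refl = contradiction (here refl) x∉ws
  ... | no  _    = extend-∉ es (x∉ws ∘ there)

  extend-fv : ∀ {σ es e} → Unique (map fv es) → e ∈ es → extend σ es (fv e) ≡ sub e ⟪ σ ⟫
  extend-fv {es = e ∷ _} _ (here refl) with fv e ≟V fv e
  ... | yes refl = refl
  ... | no  w≢w  = contradiction refl w≢w
  extend-fv {es = e₀ ∷ _} {e} (w∉ws ∷ ws-unique) (there e∈) with fv e₀ ≟V fv e
  ... | yes w≡w′ = contradiction w≡w′ (All.lookup w∉ws (∈-map⁺ fv e∈))
  ... | no  _    = extend-fv ws-unique e∈

  module Correct
    {S} {X : List Var} {s : Term 𝒮 S} {xs : List Var} {φ : Term 𝒮 BoolS}
    (FV⊆X : FV 𝒮 (∃⟨ xs ⟩ φ) ⊆ X)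
    (X⊆s : X ⊆ vars 𝒮 s)
    (xs∉s : ∀ x → x ∈ xs → x ∉ vars 𝒮 s)
    {es : List (Entry 𝒮)}
    (ps-unique : Unique (map pos es))
    (ps-spec : ∀ p → (p ∈ map pos es) ⇔ PosIn 𝒮 X s p)
    (s∣ps : All (λ e → s ∣ pos e ≡ just (sortV (fv e) , sub e)) es)
    (ws-unique : Unique (map fv es))
    (ws-fresh : All (λ e → fv e ∉ vars 𝒮 s × fv e ∉ vars 𝒮 φ × fv e ∉ xs × fv e ∉ X) es)
    {Y : List Var} (Y-spec : ∀ v → (v ∈ Y) ⇔ (v ∈ map fv es))
    {t : Term 𝒮 S} (t-spec : ReplAll 𝒮 s es t)
    {ys : List Var} (ys-spec : ∀ v → (v ∈ ys) ⇔ (v ∈ xs ⊎ v ∈ X))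
    (hs : All (λ e → T (isThS (sortV (fv e)))) es)
    where

    open ≡-Reasoning

    ws : List Var
    ws = map fv es

    ψ : Term 𝒮 BoolS
    ψ = φ ∧ₜ ⋀ 𝒮 es hs

    A B : CTerm 𝒮 S
    A = Π X ∙ s [ ∃⟨ xs ⟩ φ ]
    B = Π Y ∙ t [ ∃⟨ ys ⟩ ψ ]

    sub-root : ∀ {e} → e ∈ es → RootIn 𝒮 X (sortV (fv e) , sub e)
    sub-root {e} e∈ with to (ps-spec (pos e)) (∈-map⁺ pos e∈)
    ... | u , s∣p≡u , u-root =
      subst (RootIn 𝒮 X) (just-injective (trans (sym s∣p≡u) (All.lookup s∣ps e∈))) u-root

    sub-⟪⟫-cong : ∀ {σ τ e} → e ∈ es → (∀ x → x ∈ X → σ x ≡ τ x) → sub e ⟪ σ ⟫ ≡ sub e ⟪ τ ⟫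
    sub-⟪⟫-cong {e = e} e∈ σ≗τ = ⟪⟫-cong (sub e) (λ x → σ≗τ x ∘ RootIn-vars (sub e) (sub-root e∈))

    ∈ws⇒fresh : x ∈ ws → x ∉ vars 𝒮 s × x ∉ xs × x ∉ X
    ∈ws⇒fresh x∈ws with ∈-map⁻ fv x∈ws
    ... | e , e∈ , refl = let w∉s , _ , w∉xs , w∉X = All.lookup ws-fresh e∈ in w∉s , w∉xs , w∉X

    s∩ws=∅ : x ∈ vars 𝒮 s → x ∉ ws
    s∩ws=∅ x∈s x∈ws = proj₁ (∈ws⇒fresh x∈ws) x∈s

    X∩ws=∅ : x ∈ X → x ∉ ws
    X∩ws=∅ x∈X x∈ws = proj₂ (proj₂ (∈ws⇒fresh x∈ws)) x∈X

    X∩xs=∅ : x ∈ X → x ∉ xs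
    X∩xs=∅ x∈X x∈xs = xs∉s _ x∈xs (X⊆s x∈X)

    X⊆ys : X ⊆ ys
    X⊆ys = from (ys-spec _) ∘ inj₂

    xs⊆ys : xs ⊆ ys
    xs⊆ys = from (ys-spec _) ∘ inj₁

    ws∩ys=∅ : x ∈ ws → x ∉ ys
    ws∩ys=∅ x∈ws x∈ys with to (ys-spec _) x∈ys
    ... | inj₁ x∈xs = proj₁ (proj₂ (∈ws⇒fresh x∈ws)) x∈xs
    ... | inj₂ x∈X  = X∩ws=∅ x∈X x∈ws

    φ⊆ys : vars 𝒮 φ ⊆ ys
    φ⊆ys {x} x∈φ with x ∈? xs
    ... | yes x∈xs = xs⊆ys x∈xs
    ... | no  x∉xs = X⊆ys (FV⊆X (∈-FV⁺ (∃⟨ xs ⟩ φ) x∈φ x∉xs))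

    FV-ψ⊆ws : FV 𝒮 (∃⟨ ys ⟩ ψ) ⊆ ws
    FV-ψ⊆ws x∈FV with ∈-FV⁻ (∃⟨ ys ⟩ ψ) x∈FV
    ... | x∈ψ , x∉ys with ∈-vars-∧ₜ⁻ φ (⋀ 𝒮 es hs) x∈ψ
    ... | inj₁ x∈φ = contradiction (φ⊆ys x∈φ) x∉ys
    ... | inj₂ x∈⋀ with ∈-vars-⋀⁻ es hs x∈⋀
    ... | e , e∈ , inj₁ x∈sub = contradiction (X⊆ys (RootIn-vars (sub e) (sub-root e∈) x∈sub)) x∉ys
    ... | e , e∈ , inj₂ refl  = ∈-map⁺ fv e∈

    t⟪⟫≡s⟪⟫ : ∀ {τ} → (∀ {e} → e ∈ es → τ (fv e) ≡ sub e ⟪ τ ⟫) → t ⟪ τ ⟫ ≡ s ⟪ τ ⟫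
    t⟪⟫≡s⟪⟫ τ-ws = ReplAll-⟪⟫ t-spec ps-unique s∣ps
      (All.tabulate (λ {e} e∈ → RootIn⇒IsLeaf (sub e) (sub-root e∈))) (All.tabulate τ-ws)

    -- Every occurrence of a variable of X in s lies at one of the replaced positions.
    t-vars-∉ws⇒∉X : x ∈ vars 𝒮 t → x ∉ ws → x ∉ X
    t-vars-∉ws⇒∉X {x} x∈t x∉ws x∈X =
      let q , t∣q = ∈-vars⇒∣ t x∈t
          s∣q , q∉ps = ReplAll-∣-var⁻ {q = q} t-spec t∣q x∉ws
      in q∉ps (from (ps-spec q) ((sortV x , var x) , s∣q , x∈X))

    s⟪⟫≡t⟪extend⟫ : ∀ {σ} → s ⟪ σ ⟫ ≡ t ⟪ extend σ es ⟫
    s⟪⟫≡t⟪extend⟫ {σ} = begin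
      s ⟪ σ ⟫ ≡⟨ ⟪⟫-cong s (λ _ → sym ∘ extend-∉ es ∘ s∩ws=∅) ⟩
      s ⟪ γ ⟫ ≡⟨ t⟪⟫≡s⟪⟫ γ-sub ⟨
      t ⟪ γ ⟫ ∎
      where
      γ = extend σ es

      γ-sub : ∀ {e} → e ∈ es → γ (fv e) ≡ sub e ⟪ γ ⟫
      γ-sub e∈ = trans (extend-fv ws-unique e∈) (sub-⟪⟫-cong e∈ (λ _ → sym ∘ extend-∉ es ∘ X∩ws=∅))

    t⟪⟫≡s⟪override⟫ : ∀ {γ θ} → (∀ {e} → e ∈ es → sub e ⟪ θ ⟫ ≡ γ (fv e)) →
                      t ⟪ γ ⟫ ≡ s ⟪ override X θ γ ⟫
    t⟪⟫≡s⟪override⟫ {γ} {θ} θsub≡γw = begin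
      t ⟪ γ ⟫ ≡⟨ ⟪⟫-cong t γ≗τ ⟩
      t ⟪ τ ⟫ ≡⟨ t⟪⟫≡s⟪⟫ τ-sub ⟩
      s ⟪ τ ⟫ ≡⟨ ⟪⟫-cong s (λ _ → override-∉ ∘ s∩ws=∅) ⟩
      s ⟪ σ ⟫ ∎
      where
      σ = override X θ γ
      τ = override ws γ σ

      γ≗τ : ∀ x → x ∈ vars 𝒮 t → γ x ≡ τ x
      γ≗τ x x∈t with x ∈? ws
      ... | yes _    = refl
      ... | no  x∉ws = sym (override-∉ (t-vars-∉ws⇒∉X x∈t x∉ws))

      τ-sub : ∀ {e} → e ∈ es → τ (fv e) ≡ sub e ⟪ τ ⟫
      τ-sub {e} e∈ = begin
        τ (fv e)    ≡⟨ override-∈ (∈-map⁺ fv e∈) ⟩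
        γ (fv e)    ≡⟨ θsub≡γw e∈ ⟨
        sub e ⟪ θ ⟫ ≡⟨ sub-⟪⟫-cong e∈ (λ _ → sym ∘ override-∈) ⟩
        sub e ⟪ σ ⟫ ≡⟨ sub-⟪⟫-cong e∈ (λ _ → sym ∘ override-∉ ∘ X∩ws=∅) ⟩
        sub e ⟪ τ ⟫ ∎

    ⊨ψ⇔ : ∀ {η γ} → Valued 𝒮 η X → Valued 𝒮 γ ws →
          ρ ⊨ ψ ⟪ override ys η γ ⟫ ⇔ (ρ ⊨ φ ⟪ η ⟫ × (∀ {e} → e ∈ es → sub e ⟪ η ⟫ ≡ γ (fv e)))
    ⊨ψ⇔ {ρ = ρ} {η} {γ} η-X γ-ws = mk⇔
      (λ ⊨ψκ → let ⊨φκ , ⊨⋀κ = to (⊨-∧ₜ (φ ⟪ κ ⟫) (⋀ 𝒮 es hs ⟪ κ ⟫)) ⊨ψκ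
               in subst (ρ ⊨_) φκ≡φη ⊨φκ ,
                  λ {e} e∈ → to (⊨eq⇔ e∈) (to (⊨-⋀ es hs) ⊨⋀κ (All.lookup hs e∈) e∈))
      (λ (⊨φη , eqs) → from (⊨-∧ₜ (φ ⟪ κ ⟫) (⋀ 𝒮 es hs ⟪ κ ⟫))
         (subst (ρ ⊨_) (sym φκ≡φη) ⊨φη , from (⊨-⋀ es hs) (λ {e} _ e∈ → from (⊨eq⇔ e∈) (eqs e∈))))
      where
      κ = override ys η γ

      φκ≡φη : φ ⟪ κ ⟫ ≡ φ ⟪ η ⟫
      φκ≡φη = ⟪⟫-cong φ (λ x → override-∈ ∘ φ⊆ys)

      ⊨eq⇔ : ∀ {e} {h : T (isThS (sortV (fv e)))} → e ∈ es →
             ρ ⊨ eqAt 𝒮 e h ⟪ κ ⟫ ⇔ sub e ⟪ η ⟫ ≡ γ (fv e)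
      ⊨eq⇔ {e} {h} e∈
        rewrite sub-⟪⟫-cong {σ = κ} {τ = η} e∈ (λ x → override-∈ ∘ X⊆ys)
              | override-∉ {τ = η} {σ = γ} (ws∩ys=∅ (∈-map⁺ fv e∈)) =
        ⊨-eq⇔≡ h _ _ (RootIn-valued (sub e) (sub-root e∈) η-X) (γ-ws (fv e) (∈-map⁺ fv e∈))

    A⊑B : A ⊑ B
    A⊑B σ σ-X (σ-FV , σ⊨) = γ , γ-Y , (γ-FV , γ⊨) , s⟪⟫≡t⟪extend⟫
      where
      γ = extend σ es

      γ-ws : Valued 𝒮 γ ws
      γ-ws x x∈ws with ∈-map⁻ fv x∈ws
      ... | e , e∈ , refl =
        subst (IsValue 𝒮) (sym (extend-fv ws-unique e∈)) (RootIn-valued (sub e) (sub-root e∈) σ-X)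

      γ-Y : Valued 𝒮 γ Y
      γ-Y x = γ-ws x ∘ to (Y-spec x)

      γ-FV : Valued 𝒮 γ (FV 𝒮 (∃⟨ ys ⟩ ψ))
      γ-FV x = γ-ws x ∘ FV-ψ⊆ws

      γ⊨ : ∀ ρ → ρ ⊨∃ ∃⟨ ys ⟩ ψ ⟪ γ ⟫∃
      γ⊨ ρ with to (⊨∃-⟪⟫∃ (∃⟨ xs ⟩ φ) σ-FV) (σ⊨ ρ)
      ... | θ , θ-xs , ρ⊨φ = from (⊨∃-⟪⟫∃ (∃⟨ ys ⟩ ψ) γ-FV)
        (η , η-ys , from (⊨ψ⇔ (λ x → η-ys x ∘ X⊆ys) γ-ws) (ρ⊨φ , ηsub≡γw))
        where
        η = override xs θ σ

        η-ys : Valued 𝒮 η ys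
        η-ys y y∈ys with to (ys-spec y) y∈ys
        ... | inj₁ y∈xs = subst (IsValue 𝒮) (sym (override-∈ y∈xs)) (θ-xs y y∈xs)
        ... | inj₂ y∈X  = subst (IsValue 𝒮) (sym (override-∉ (X∩xs=∅ y∈X))) (σ-X y y∈X)

        ηsub≡γw : ∀ {e} → e ∈ es → sub e ⟪ η ⟫ ≡ γ (fv e)
        ηsub≡γw e∈ = trans (sub-⟪⟫-cong e∈ (λ _ → override-∉ ∘ X∩xs=∅)) (sym (extend-fv ws-unique e∈))

    B⊑A : B ⊑ A
    B⊑A γ γ-Y (γ-FV , γ⊨) = σ , σ-X , (σ-FV , σ⊨) , t⟪⟫≡s⟪override⟫ θsub≡γw
      where
      γ-ws : Valued 𝒮 γ ws
      γ-ws x = γ-Y x ∘ from (Y-spec x)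

      -- One valuation suffices to obtain θ, because φ ⟪ θ ⟫ is ground and so true at every valuation.
      ρ₀ : Valuation 𝒮
      ρ₀ x = inhabited (sortV x)

      θ-witness : ∃[ θ ] Valued 𝒮 θ ys × ρ₀ ⊨ ψ ⟪ override ys θ γ ⟫
      θ-witness = to (⊨∃-⟪⟫∃ (∃⟨ ys ⟩ ψ) γ-FV) (γ⊨ ρ₀)

      θ = proj₁ θ-witness

      θ-ys : Valued 𝒮 θ ys
      θ-ys = proj₁ (proj₂ θ-witness)

      ρ₀⊨φθ×θsub≡γw = to (⊨ψ⇔ (λ x → θ-ys x ∘ X⊆ys) γ-ws) (proj₂ (proj₂ θ-witness))

      ρ₀⊨φθ : ρ₀ ⊨ φ ⟪ θ ⟫
      ρ₀⊨φθ = proj₁ ρ₀⊨φθ×θsub≡γw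

      θsub≡γw : ∀ {e} → e ∈ es → sub e ⟪ θ ⟫ ≡ γ (fv e)
      θsub≡γw = proj₂ ρ₀⊨φθ×θsub≡γw

      σ = override X θ γ

      σ-X : Valued 𝒮 σ X
      σ-X x x∈X = subst (IsValue 𝒮) (sym (override-∈ x∈X)) (θ-ys x (X⊆ys x∈X))

      σ-FV : Valued 𝒮 σ (FV 𝒮 (∃⟨ xs ⟩ φ))
      σ-FV x = σ-X x ∘ FV⊆X

      φ⟪xs↦θ⟫≡φ⟪θ⟫ : φ ⟪ override xs θ σ ⟫ ≡ φ ⟪ θ ⟫
      φ⟪xs↦θ⟫≡φ⟪θ⟫ = ⟪⟫-cong φ pointwise
        where
        pointwise : ∀ x → x ∈ vars 𝒮 φ → override xs θ σ x ≡ θ x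
        pointwise x x∈φ with x ∈? xs
        ... | yes _    = refl
        ... | no  x∉xs = override-∈ (FV⊆X (∈-FV⁺ (∃⟨ xs ⟩ φ) x∈φ x∉xs))

      σ⊨ : ∀ ρ → ρ ⊨∃ ∃⟨ xs ⟩ φ ⟪ σ ⟫∃
      σ⊨ ρ = from (⊨∃-⟪⟫∃ (∃⟨ xs ⟩ φ) σ-FV)
        (θ , (λ x → θ-ys x ∘ xs⊆ys) ,
         subst (ρ ⊨_) (sym φ⟪xs↦θ⟫≡φ⟪θ⟫)
           (⊨-valued-⟪⟫ φ (λ x → θ-ys x ∘ φ⊆ys) ρ₀⊨φθ))

theorem2 : (𝒮 : Setting) {S : Setting.Sort 𝒮} (A B : CTerm 𝒮 S) →
    IsECT 𝒮 A → IsPG 𝒮 A B → _∼_ 𝒮 A B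
theorem2 𝒮 (Π X ∙ s [ ∃⟨ xs ⟩ φ ]) (Π Y ∙ t [ ∃⟨ ys ⟩ _ ]) (_ , _ , FV⊆X , X⊆s , xs∉s)
         (es , ps-unique , ps-spec , s∣ps , ws-unique , ws-fresh , Y-spec , t-spec , ys-spec ,
          hs , refl) =
  A⊑B , B⊑A
  where
  open PG.Correct 𝒮 {φ = φ} FV⊆X X⊆s xs∉s
                   ps-unique ps-spec s∣ps ws-unique ws-fresh Y-spec t-spec ys-spec hs
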